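{- Let $k \ge 2$ be an integer, and let $\mathcal{G}$ be the Grundy function of the Maximum Nim with rule function $f(x)=\left\lfloor \frac{x}{k}\right\rfloor$. Let $x$ be a non-negative integer. (i) If $x$ is a multiple of $k$, then $\mathcal{G}(x)=\frac{x}{k}$. (ii) If $x$ is not a multiple of $k$, then $\mathcal{G}(x)=\mathcal{G}\!\left(\left\lfloor \frac{(k-1)x}{k}\right\rfloor\right)$.
   Context: Here $\lfloor y\rfloor$ denotes the greatest integer less than or equal to $y$. Maximum Nim with rule function $f$ is the following game. There is a single pile of stones. When the pile has $m$ stones, a move removes $u$ stones for some integer $u$ with $1\le u\le f(m)$. Two players alternate moves, and the player who removes the last stone wins. The mex of a set $S$ of non-negative integers is the smallest non-negative integer not in $S$. The Grundy number of a position with $x$ stones is defined recursively by $\mathcal{G}(x)=\mathrm{mex}\{\mathcal{G}(x-u): u\in\mathbb{N},\ 1\le u\le f(x)\}$. When $f(x)=0$ the set is empty and $\mathcal{G}(x)=0$. -}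

module Defs where

open import Data.Nat using (ℕ; zero; suc; _+_; _∸_; _≤ᵇ_; _≡ᵇ_; _<ᵇ_)
open import Data.Bool using (Bool; true; false; if_then_else_; _∨_; _∧_)
open import Data.List using (List; []; _∷_; _++_; length; any; map)

elemᵇ : ℕ → List ℕ → Bool
elemᵇ n []       = false
elemᵇ n (m ∷ ms) = (n ≡ᵇ m) ∨ elemᵇ n ms

-- mex of a finite set (given as a list): least natural not in the list.
-- The mex is at most the length of the list, so searching length+1 candidates suffices.
mexFrom : ℕ → ℕ → List ℕ → ℕ
mexFrom i zero    s = i
mexFrom i (suc f) s = if elemᵇ i s then mexFrom (suc i) f s else i

mex : List ℕ → ℕ
mex s = mexFrom 0 (length s) s

index : List ℕ → ℕ → ℕ
index []       _       = 0
index (a ∷ as) zero    = a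
index (a ∷ as) (suc i) = index as i

range : ℕ → ℕ → List ℕ
range a zero    = []
range a (suc n) = a ∷ range (suc a) n

-- Grundy table for Maximum Nim with rule function f:
-- table f n = [G(0), G(1), ..., G(n-1)].
-- Position x has options x - u for 1 ≤ u ≤ f(x) (and u ≤ x, so the pile
-- stays non-negative; for f(x) = ⌊x/k⌋ this extra condition is automatic).
validOpt : ℕ → ℕ → Bool
validOpt x u = u ≤ᵇ x

filterOpts : ℕ → List ℕ → List ℕ
filterOpts x []       = []
filterOpts x (u ∷ us) = if validOpt x u then (x ∸ u) ∷ filterOpts x us else filterOpts x us

table : (ℕ → ℕ) → ℕ → List ℕ
table f zero    = []
table f (suc n) =
  let t = table f n in
  t ++ (mex (map (index t) (filterOpts n (range 1 (f n)))) ∷ [])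

grundy : (ℕ → ℕ) → ℕ → ℕ
grundy f x = index (table f (suc x)) x

-- Write G for the Grundy function and c(n) = ⌈n/k⌉.  By induction on n, G maps the
-- window [n − c(n), n) bijectively onto [0, c(n)).  The options of n form the window
-- [n − ⌊n/k⌋, n).  If k ∣ n this is the whole window, so G(n) = n/k and the window
-- grows by one.  Otherwise it is the window without its first point s, so
-- G(n) = G(s) and the window slides by one; for n = t + qk with 1 ≤ t < k that point
-- is s = ⌊(k − 1)n/k⌋.
module Submission where

open import Defs
open import Data.Nat using (ℕ; _*_; _∸_; _≥_; _/_; NonZero)
open import Data.Nat.Divisibility using (_∣_)
open import Data.Product using (_×_)
open import Relation.Nullary using (¬_)
open import Relation.Binary.PropositionalEquality using (_≡_)

open import Data.Nat using (zero; suc; _+_; _≤_; _<_; z≤n; s≤s; _≡ᵇ_; _%_)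
open import Data.Nat.Properties
open import Data.Nat.DivMod using (m≡m%n+[m/n]*n; m%n<n; m*n/n≡m; m/n*n≡m; m<n⇒m/n≡0; +-distrib-/-∣ʳ)
open import Data.Nat.Divisibility using (m%n≡0⇒n∣m; divides-refl)
open import Data.Nat.Tactic.RingSolver using (solve-∀)
open import Data.Bool using (true; false)
open import Data.Bool.Properties using (∨-zeroʳ; T-≡)
open import Data.List using ([]; _∷_; _++_; length; map)
open import Data.List.Properties using (length-map; length-++)
open import Data.List.Relation.Unary.Any using (here; there)
open import Data.List.Membership.Propositional using (_∈_; _∉_)
open import Data.List.Membership.Propositional.Properties using (∈-map⁺; ∈-map⁻)
open import Data.Product using (∃; _,_; proj₁)
open import Data.Sum using (_⊎_; inj₁; inj₂)
open import Function using (_∘_)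
open import Function.Bundles using (Equivalence)
open import Relation.Nullary using (contradiction)
open import Relation.Binary.PropositionalEquality using (refl; sym; trans; cong; cong₂; subst; _≢_; module ≡-Reasoning)

∈⇒elemᵇ : ∀ {n ms} → n ∈ ms → elemᵇ n ms ≡ true
∈⇒elemᵇ {n} (here refl) rewrite Equivalence.to T-≡ (≡⇒≡ᵇ n n refl) = refl
∈⇒elemᵇ {n} {m ∷ _} (there n∈ms) rewrite ∈⇒elemᵇ n∈ms = ∨-zeroʳ (n ≡ᵇ m)

elemᵇ⇒∈ : ∀ {n} ms → elemᵇ n ms ≡ true → n ∈ ms
elemᵇ⇒∈ {n} (m ∷ ms) p with n ≡ᵇ m in n≡ᵇm
... | true  = here (≡ᵇ⇒≡ n m (Equivalence.from T-≡ n≡ᵇm))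
... | false = there (elemᵇ⇒∈ ms p)

∉⇒elemᵇ : ∀ {n ms} → n ∉ ms → elemᵇ n ms ≡ false
∉⇒elemᵇ {n} {ms} n∉ms with elemᵇ n ms in eq
... | true  = contradiction (elemᵇ⇒∈ ms eq) n∉ms
... | false = refl

mexFrom-unique : ∀ fuel i {m} s → i ≤ m → m ≤ i + fuel →
                 (∀ {v} → i ≤ v → v < m → v ∈ s) → m ∉ s → mexFrom i fuel s ≡ m
mexFrom-unique zero i {m} s i≤m m≤i+0 _ _ = ≤-antisym i≤m (subst (m ≤_) (+-identityʳ i) m≤i+0)
mexFrom-unique (suc fuel) i {m} s i≤m m≤ below m∉s with m≤n⇒m<n∨m≡n i≤m
... | inj₁ i<m rewrite ∈⇒elemᵇ (below ≤-refl i<m) =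
  mexFrom-unique fuel (suc i) s i<m (subst (m ≤_) (+-suc i fuel) m≤)
    (λ i<v v<m → below (<⇒≤ i<v) v<m) m∉s
... | inj₂ refl rewrite ∉⇒elemᵇ m∉s = refl

mex-unique : ∀ {m} s → m ≤ length s → (∀ {v} → v < m → v ∈ s) → m ∉ s → mex s ≡ m
mex-unique s m≤length below m∉s = mexFrom-unique (length s) 0 s z≤n m≤length (λ _ → below) m∉s

length-range : ∀ a n → length (range a n) ≡ n
length-range a zero    = refl
length-range a (suc n) = cong suc (length-range (suc a) n)

∈-range⁺ : ∀ {a n u} → a ≤ u → u < a + n → u ∈ range a n
∈-range⁺ {a} {zero} {u} a≤u u<a+0 = contradiction a≤u (<⇒≱ (subst (u <_) (+-identityʳ a) u<a+0))
∈-range⁺ {a} {suc n} {u} a≤u u<a+1+n with m≤n⇒m<n∨m≡n a≤u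
... | inj₁ a<u  = there (∈-range⁺ a<u (subst (u <_) (+-suc a n) u<a+1+n))
... | inj₂ refl = here refl

∈-range⁻ : ∀ {a n u} → u ∈ range a n → a ≤ u × u < a + n
∈-range⁻ {a} {suc n} (here refl) = ≤-refl , m<m+n a (s≤s z≤n)
∈-range⁻ {a} {suc n} {u} (there u∈) =
  let a<u , u<1+a+n = ∈-range⁻ u∈ in <⇒≤ a<u , subst (u <_) (sym (+-suc a n)) u<1+a+n

index-++ : ∀ t a {i} → i < length t → index (t ++ a) i ≡ index t i
index-++ (_ ∷ t) a {zero}  _         = refl
index-++ (_ ∷ t) a {suc i} (s≤s i<) = index-++ t a i<

index-last : ∀ t a → index (t ++ a ∷ []) (length t) ≡ a
index-last []      a = refl
index-last (_ ∷ t) a = index-last t a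

length-table : ∀ f n → length (table f n) ≡ n
length-table f zero    = refl
length-table f (suc n) =
  trans (length-++ (table f n)) (trans (cong (_+ 1) (length-table f n)) (+-comm n 1))

table-index : ∀ f {n i} → i < n → index (table f n) i ≡ grundy f i
table-index f {suc n} {i} (s≤s i≤n) with m≤n⇒m<n∨m≡n i≤n
... | inj₁ i<n  = trans (index-++ (table f n) _ (subst (i <_) (sym (length-table f n)) i<n))
                        (table-index f i<n)
... | inj₂ refl = refl

grundy-table : ∀ f x → grundy f x ≡ mex (map (index (table f x)) (filterOpts x (range 1 (f x))))
grundy-table f x =
  subst (λ l → index (table f x ++ g ∷ []) l ≡ g) (length-table f x) (index-last (table f x) g)
  where g = mex (map (index (table f x)) (filterOpts x (range 1 (f x))))

filterOpts-legal : ∀ {x u} us → u ≤ x → filterOpts x (u ∷ us) ≡ (x ∸ u) ∷ filterOpts x us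
filterOpts-legal _ u≤x rewrite Equivalence.to T-≡ (≤⇒≤ᵇ u≤x) = refl

options-table : ∀ f x {a} n → 1 ≤ a → a + n ≤ suc x →
                map (index (table f x)) (filterOpts x (range a n)) ≡ map (λ u → grundy f (x ∸ u)) (range a n)
options-table f x zero    _   _     = refl
options-table f x {a} (suc n) 1≤a bound =
  trans (cong (map (index (table f x))) (filterOpts-legal (range (suc a) n) a≤x))
        (cong₂ _∷_ (table-index f (∸-monoʳ-< 1≤a a≤x)) (options-table f x n (s≤s z≤n) bound′))
  where
  bound′ : suc a + n ≤ suc x
  bound′ = subst (_≤ suc x) (+-suc a n) bound
  a≤x : a ≤ x
  a≤x = ≤-pred (≤-trans (s≤s (m≤m+n a n)) bound′)

grundy-unfold : ∀ f x → f x ≤ x → grundy f x ≡ mex (map (λ u → grundy f (x ∸ u)) (range 1 (f x)))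
grundy-unfold f x fx≤x = trans (grundy-table f x) (cong mex (options-table f x (f x) ≤-refl (s≤s fx≤x)))

InWindow : ℕ → ℕ → ℕ → Set
InWindow s c i = s ≤ i × i < s + c

InWindow-split : ∀ {s c i} → InWindow s (suc c) i → InWindow s c i ⊎ i ≡ s + c
InWindow-split {s} {c} {i} (s≤i , i<) with m≤n⇒m<n∨m≡n (≤-pred (subst (i <_) (+-suc s c) i<))
... | inj₁ i<s+c = inj₁ (s≤i , i<s+c)
... | inj₂ i≡s+c = inj₂ i≡s+c

InWindow-widen : ∀ {s c i} → InWindow s c i → InWindow s (suc c) i
InWindow-widen {s} {c} (s≤i , i<) = s≤i , <-≤-trans i< (+-monoʳ-≤ s (n≤1+n c))

InWindow-head : ∀ {s c} → InWindow s (suc c) s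
InWindow-head {s} = ≤-refl , m<m+n s (s≤s z≤n)

InWindow-last : ∀ {s c} → InWindow s (suc c) (s + c)
InWindow-last {s} {c} = m≤m+n s c , +-monoʳ-< s (n<1+n c)

InWindow-tail : ∀ {s c i} → InWindow s (suc c) i → s < i → InWindow (suc s) c i
InWindow-tail {s} {c} {i} (_ , i<) s<i = s<i , subst (i <_) (+-suc s c) i<

InWindow-shift : ∀ {s c i} → InWindow (suc s) c i → InWindow s (suc c) i
InWindow-shift {s} {c} {i} (s<i , i<) = <⇒≤ s<i , subst (i <_) (sym (+-suc s c)) i<

-- The options of s + c are exactly the positions of the window [s, s + c).
grundy-window : ∀ f {s c m} → f (s + c) ≡ c → m ≤ c →
                (∀ {v} → v < m → ∃ λ i → InWindow s c i × grundy f i ≡ v) →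
                (∀ {i} → InWindow s c i → grundy f i ≢ m) →
                grundy f (s + c) ≡ m
grundy-window f {s} {c} {m} fx≡c m≤c hit miss = begin
  grundy f x                            ≡⟨ grundy-unfold f x (subst (_≤ x) (sym fx≡c) (m≤n+m c s)) ⟩
  mex (map option (range 1 (f x)))      ≡⟨ cong (mex ∘ map option ∘ range 1) fx≡c ⟩
  mex (map option (range 1 c))          ≡⟨ mex-unique _ m≤length below m∉ ⟩
  m                                     ∎
  where
  open ≡-Reasoning
  x = s + c
  option : ℕ → ℕ
  option u = grundy f (x ∸ u)
  m≤length : m ≤ length (map option (range 1 c))
  m≤length = subst (m ≤_) (sym (trans (length-map option (range 1 c)) (length-range 1 c))) m≤c
  below : ∀ {v} → v < m → v ∈ map option (range 1 c)
  below v<m with hit v<m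
  ... | i , (s≤i , i<x) , gi≡v =
    subst (_∈ _) (trans (cong (grundy f) (m∸[m∸n]≡n (<⇒≤ i<x))) gi≡v)
      (∈-map⁺ option (∈-range⁺ (m<n⇒0<n∸m i<x)
        (s≤s (subst (x ∸ i ≤_) (m+n∸m≡n s c) (∸-monoʳ-≤ x s≤i)))))
  m∉ : m ∉ map option (range 1 c)
  m∉ m∈ with ∈-map⁻ option m∈
  ... | u , u∈ , m≡ with ∈-range⁻ u∈
  ...   | 1≤u , s≤s u≤c =
    miss (subst (_≤ x ∸ u) (m+n∸n≡m s c) (∸-monoʳ-≤ x u≤c) ,
          ∸-monoʳ-< 1≤u (≤-trans u≤c (m≤n+m c s)))
         (sym m≡)

record WindowBijection (g : ℕ → ℕ) (s c : ℕ) : Set where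
  field
    injective  : ∀ {i i′} → InWindow s c i → InWindow s c i′ → g i ≡ g i′ → i ≡ i′
    bounded    : ∀ {i} → InWindow s c i → g i < c
    surjective : ∀ {v} → v < c → ∃ λ i → InWindow s c i × g i ≡ v

InWindow-empty : ∀ {s i} → ¬ InWindow s 0 i
InWindow-empty {s} {i} (s≤i , i<s+0) = <⇒≱ (subst (i <_) (+-identityʳ s) i<s+0) s≤i

WindowBijection-empty : ∀ {g s} → WindowBijection g s 0
WindowBijection-empty = record
  { injective  = λ w → contradiction w InWindow-empty
  ; bounded    = λ w → contradiction w InWindow-empty
  ; surjective = λ ()
  }

module _ {g : ℕ → ℕ} {s c : ℕ} where

  WindowBijection-extend : WindowBijection g s c → g (s + c) ≡ c → WindowBijection g s (suc c)
  WindowBijection-extend W g[s+c]≡c = record { injective = inj ; bounded = bnd ; surjective = surj }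
    where
    open WindowBijection W
    fresh : ∀ {i} → InWindow s c i → g i ≢ g (s + c)
    fresh w eq = <⇒≢ (bounded w) (trans eq g[s+c]≡c)
    inj : ∀ {i i′} → InWindow s (suc c) i → InWindow s (suc c) i′ → g i ≡ g i′ → i ≡ i′
    inj w w′ eq with InWindow-split w | InWindow-split w′
    ... | inj₁ u    | inj₁ u′   = injective u u′ eq
    ... | inj₁ u    | inj₂ refl = contradiction eq (fresh u)
    ... | inj₂ refl | inj₁ u′   = contradiction (sym eq) (fresh u′)
    ... | inj₂ refl | inj₂ refl = refl
    bnd : ∀ {i} → InWindow s (suc c) i → g i < suc c
    bnd w with InWindow-split w
    ... | inj₁ u    = m<n⇒m<1+n (bounded u)
    ... | inj₂ refl = s≤s (≤-reflexive g[s+c]≡c)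
    surj : ∀ {v} → v < suc c → ∃ λ i → InWindow s (suc c) i × g i ≡ v
    surj (s≤s v≤c) with m≤n⇒m<n∨m≡n v≤c
    ... | inj₁ v<c  = let i , w , eq = surjective v<c in i , InWindow-widen w , eq
    ... | inj₂ refl = s + c , InWindow-last , g[s+c]≡c

  tail-avoids-head : WindowBijection g s (suc c) → ∀ {i} → InWindow (suc s) c i → g i ≢ g s
  tail-avoids-head W w@(s<i , _) eq = <⇒≢ s<i (sym (injective (InWindow-shift w) InWindow-head eq))
    where open WindowBijection W

  WindowBijection-slide : WindowBijection g s (suc c) → g (suc s + c) ≡ g s → WindowBijection g (suc s) (suc c)
  WindowBijection-slide W g[x]≡g[s] = record { injective = inj ; bounded = bnd ; surjective = surj }
    where
    open WindowBijection W
    inj : ∀ {i i′} → InWindow (suc s) (suc c) i → InWindow (suc s) (suc c) i′ → g i ≡ g i′ → i ≡ i′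
    inj w w′ eq with InWindow-split w | InWindow-split w′
    ... | inj₁ u    | inj₁ u′   = injective (InWindow-shift u) (InWindow-shift u′) eq
    ... | inj₁ u    | inj₂ refl = contradiction (trans eq g[x]≡g[s]) (tail-avoids-head W u)
    ... | inj₂ refl | inj₁ u′   = contradiction (trans (sym eq) g[x]≡g[s]) (tail-avoids-head W u′)
    ... | inj₂ refl | inj₂ refl = refl
    bnd : ∀ {i} → InWindow (suc s) (suc c) i → g i < suc c
    bnd w with InWindow-split w
    ... | inj₁ u    = bounded (InWindow-shift u)
    ... | inj₂ refl = subst (_< suc c) (sym g[x]≡g[s]) (bounded InWindow-head)
    surj : ∀ {v} → v < suc c → ∃ λ i → InWindow (suc s) (suc c) i × g i ≡ v
    surj v<1+c with surjective v<1+c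
    ... | i , w , eq with m≤n⇒m<n∨m≡n (proj₁ w)
    ...   | inj₁ s<i  = i , InWindow-widen (InWindow-tail w s<i) , eq
    ...   | inj₂ refl = suc s + c , InWindow-last , trans g[x]≡g[s] eq

module _ (f : ℕ → ℕ) {s c : ℕ} where

  open WindowBijection

  grundy-extend : WindowBijection (grundy f) s c → f (s + c) ≡ c → grundy f (s + c) ≡ c
  grundy-extend W fx≡c = grundy-window f fx≡c ≤-refl (surjective W) (λ w → <⇒≢ (bounded W w))

  grundy-slide : WindowBijection (grundy f) s (suc c) → f (suc s + c) ≡ c → grundy f (suc s + c) ≡ grundy f s
  grundy-slide W fx≡c =
    grundy-window f fx≡c (≤-pred (bounded W InWindow-head)) hit (tail-avoids-head W)
    where
    hit : ∀ {v} → v < grundy f s → ∃ λ i → InWindow (suc s) c i × grundy f i ≡ v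
    hit v<g[s] with surjective W (<-trans v<g[s] (bounded W InWindow-head))
    ... | i , w , eq with m≤n⇒m<n∨m≡n (proj₁ w)
    ...   | inj₁ s<i  = i , InWindow-tail w s<i , eq
    ...   | inj₂ refl = contradiction (sym eq) (<⇒≢ v<g[s])

[r+q*n]/n≡q : ∀ {r n} q .{{_ : NonZero n}} → r < n → (r + q * n) / n ≡ q
[r+q*n]/n≡q {r} {n} q r<n = begin
  (r + q * n) / n    ≡⟨ +-distrib-/-∣ʳ r (divides-refl q) ⟩
  r / n + q * n / n  ≡⟨ cong₂ _+_ (m<n⇒m/n≡0 r<n) (m*n/n≡m q n) ⟩
  q                  ∎
  where open ≡-Reasoning

private
  block-start : ∀ j q → q * suc j + q ≡ q * suc (suc j)
  block-start = solve-∀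

  block-position : ∀ j q t → suc (q * suc j + t) + q ≡ suc t + q * suc (suc j)
  block-position = solve-∀

  -- ⌊(k − 1)x/k⌋ for x = t + 1 + qk, with k = t + d + 2
  scaled-position : ∀ t d q → suc (t + d) * (suc t + q * suc (suc (t + d))) ≡
                              suc d + (q * suc (t + d) + t) * suc (suc (t + d))
  scaled-position = solve-∀

-- k = j + 2.  Before position qk the window is [q(k − 1), qk); before t + 1 + qk
-- (t < k − 1) it is [q(k − 1) + t, t + 1 + qk).
module MaximumNim (j : ℕ) where

  k : ℕ
  k = suc (suc j)

  G : ℕ → ℕ
  G = grundy (_/ k)

  rule-at-multiple : ∀ q → (q * suc j + q) / k ≡ q
  rule-at-multiple q = trans (cong (_/ k) (block-start j q)) (m*n/n≡m q k)

  rule-in-block : ∀ q {t} → t ≤ j → (suc (q * suc j + t) + q) / k ≡ q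
  rule-in-block q {t} t≤j = trans (cong (_/ k) (block-position j q t)) ([r+q*n]/n≡q q (s≤s (s≤s t≤j)))

  bijection-in-block : ∀ q → WindowBijection G (q * suc j) q →
                       ∀ t → t ≤ j → WindowBijection G (q * suc j + t) (suc q)
  bijection-in-block q W zero _ =
    subst (λ s → WindowBijection G s (suc q)) (sym (+-identityʳ _))
      (WindowBijection-extend W (grundy-extend (_/ k) W (rule-at-multiple q)))
  bijection-in-block q W (suc t) t<j =
    subst (λ s → WindowBijection G s (suc q)) (sym (+-suc _ t))
      (WindowBijection-slide W′ (grundy-slide (_/ k) W′ (rule-in-block q (<⇒≤ t<j))))
    where W′ = bijection-in-block q W t (<⇒≤ t<j)

  bijection-at-block : ∀ q → WindowBijection G (q * suc j) q
  bijection-at-block zero    = WindowBijection-empty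
  bijection-at-block (suc q) =
    subst (λ s → WindowBijection G s (suc q)) (cong suc (+-comm (q * suc j) j))
      (WindowBijection-slide W (grundy-slide (_/ k) W (rule-in-block q ≤-refl)))
    where W = bijection-in-block q (bijection-at-block q) j ≤-refl

  grundy-multiple : ∀ q → G (q * k) ≡ q
  grundy-multiple q = subst (λ x → G x ≡ q) (block-start j q)
    (grundy-extend (_/ k) (bijection-at-block q) (rule-at-multiple q))

  grundy-nonmultiple : ∀ q {t} → t ≤ j → G (suc t + q * k) ≡ G ((suc j * (suc t + q * k)) / k)
  grundy-nonmultiple q {t} t≤j with m≤n⇒∃[o]m+o≡n t≤j
  ... | d , refl = begin
    G (suc t + q * k)                  ≡⟨ cong G (block-position j q t) ⟨
    G (suc (q * suc j + t) + q)        ≡⟨ grundy-slide (_/ k) W (rule-in-block q t≤j) ⟩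
    G (q * suc j + t)                  ≡⟨ cong G ([r+q*n]/n≡q (q * suc j + t) (s≤s (s≤s (m≤n+m d t)))) ⟨
    G ((suc d + (q * suc j + t) * k) / k) ≡⟨ cong (G ∘ (_/ k)) (scaled-position t d q) ⟨
    G ((suc j * (suc t + q * k)) / k)  ∎
    where
    open ≡-Reasoning
    W = bijection-in-block q (bijection-at-block q) t t≤j

mainTheorem1 : (k : ℕ) → .{{_ : NonZero k}} → k ≥ 2 → (x : ℕ) →
    (k ∣ x → grundy (λ m → m / k) x ≡ x / k) ×
    (¬ (k ∣ x) → grundy (λ m → m / k) x ≡ grundy (λ m → m / k) (((k ∸ 1) * x) / k))
mainTheorem1 (suc (suc j)) _ x = multiple , nonmultiple
  where
  open MaximumNim j
  multiple : k ∣ x → G x ≡ x / k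
  multiple k∣x = subst (λ y → G y ≡ x / k) (m/n*n≡m k∣x) (grundy-multiple (x / k))
  nonmultiple : ¬ (k ∣ x) → G x ≡ G ((suc j * x) / k)
  nonmultiple k∤x with x % k in x%k≡r | m≡m%n+[m/n]*n x k | m%n<n x k
  ... | zero  | _       | _             = contradiction (m%n≡0⇒n∣m x k x%k≡r) k∤x
  ... | suc t | x≡r+q*k | s≤s (s≤s t≤j) =
    subst (λ y → G y ≡ G ((suc j * y) / k)) (sym x≡r+q*k) (grundy-nonmultiple (x / k) t≤j)
mainTheorem1 (suc zero) (s≤s ()) x
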